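{- Let $\omega=e^{2\pi i/3}$ and $N(a+b\omega)=(a+b\omega)(a+b\omega^2)$ for $a,b\in\mathbb Z[\omega]$-coefficient expressions (norm from $\mathbb Z[\omega]$ to $\mathbb Z$). Let $p$ be a Type 1 prime. If $p\equiv 7\pmod 9$, there exist integers $A,B$ with $p=N\big(-1-3\omega+6(\omega-1)(A\omega+B)\big)$. If $p\equiv 4\pmod 9$, there exist integers $A,B$ with $p=N\big(1-3\omega+6(\omega-1)(A\omega+B)\big)$.
   Context: $N(\alpha)=\alpha\bar\alpha$ for $\alpha\in\mathbb Z[\omega]$, so $N(a+b\omega)=a^2-ab+b^2$ for $a,b\in\mathbb Z$. A prime $p$ is a Type 1 prime if $p=N\big(2(1+3B)+3(1+2A)\omega\big)$ for some integers $A,B$. -}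

module Defs where

open import Data.Integer using (ℤ; +_; _+_; _-_; _*_; -_)
open import Data.Nat using (ℕ)
open import Data.Nat.Primality using (Prime)
open import Data.Product using (Σ; ∃₂; _×_; _,_)
open import Relation.Binary.PropositionalEquality using (_≡_)

-- Elements of ℤ[ω], ω = e^{2πi/3}, represented as mk a b = a + bω with a b : ℤ.
record ℤω : Set where
  constructor mk
  field
    re : ℤ
    im : ℤ
open ℤω public

-- ring operations on ℤ[ω], using ω² = -1 - ω
_⊕_ : ℤω → ℤω → ℤω
mk a b ⊕ mk c d = mk (a + c) (b + d)

_⊗_ : ℤω → ℤω → ℤω
mk a b ⊗ mk c d = mk (a * c - b * d) (a * d + b * c - b * d)

ι : ℤ → ℤω
ι a = mk a (+ 0)

ω : ℤω
ω = mk (+ 0) (+ 1)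

-- Norm N(a + bω) = (a + bω)(a + bω²) = a² - ab + b²
N : ℤω → ℤ
N (mk a b) = a * a - a * b + b * b

Type1Prime : ℕ → Set
Type1Prime p = Prime p × ∃₂ λ (A B : ℤ) →
  + p ≡ N (mk (+ 2 * (+ 1 + + 3 * B)) (+ 3 * (+ 1 + + 2 * A)))

{-# OPTIONS --safe #-}
-- Write p = N(x + yω) with x = 2(1 + 3B), y = 3(1 + 2A). Expanding the norm gives
-- p ≡ 7 + 6(A + B) (mod 9), so p ≡ 7 exactly when A + B ≡ 0 (mod 3) and p ≡ 4 exactly when
-- A + B ≡ 1 (mod 3). In the first case the conjugate x + yω² = (x - y) - yω, and in the second
-- its negative, is of the form ±1 - 3ω + 6(ω - 1)(A'ω + B'); both have norm p.
module Submission where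

open import Defs
open import Data.Integer using (ℤ; +_; -[1+_]; _+_; _-_; _*_; -_)
open import Data.Integer.DivMod using (_%ℕ_; _/ℕ_; a≡a%ℕn+[a/ℕn]*n; n%ℕd<d)
open import Data.Integer.Properties using (+-injective; pos-+; pos-*)
open import Data.Integer.Tactic.RingSolver using (solve-∀)
open import Data.Nat using (ℕ; NonZero; suc; _<_; s≤s)
open import Data.Nat.DivMod using (_%_; [m+kn]%n≡m%n)
open import Data.Product using (∃₂; _×_; _,_)
open import Relation.Binary.PropositionalEquality
  using (_≡_; refl; sym; trans; cong; cong₂; module ≡-Reasoning)
open import Relation.Nullary.Negation using (contradiction)

import Data.Nat as ℕ

pos-+-* : ∀ a b c → + (a ℕ.+ b ℕ.* c) ≡ + a + + b * + c
pos-+-* a b c = trans (pos-+ a (b ℕ.* c)) (cong (_+_ (+ a)) (pos-* b c))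

n≡c+M*d⇒n%d≡c%d : ∀ n c d .{{_ : NonZero d}} (M : ℤ) → + n ≡ + c + M * + d → n % d ≡ c % d
n≡c+M*d⇒n%d≡c%d n c d (+ m) n≡c+md = begin
  n % d               ≡⟨ cong (_% d) (+-injective (trans n≡c+md (sym (pos-+-* c m d)))) ⟩
  (c ℕ.+ m ℕ.* d) % d ≡⟨ [m+kn]%n≡m%n c m d ⟩
  c % d               ∎
  where open ≡-Reasoning
n≡c+M*d⇒n%d≡c%d n c d -[1+ m ] n≡c-md = sym (begin
  c % d                   ≡⟨ cong (_% d) (+-injective c≡n+md) ⟩
  (n ℕ.+ suc m ℕ.* d) % d ≡⟨ [m+kn]%n≡m%n n (suc m) d ⟩
  n % d                   ∎)
  where
  open ≡-Reasoning
  x≡[x-y*z]+y*z : ∀ x y z → x ≡ (x + - y * z) + y * z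
  x≡[x-y*z]+y*z = solve-∀
  c≡n+md : + c ≡ + (n ℕ.+ suc m ℕ.* d)
  c≡n+md = begin
    + c                                    ≡⟨ x≡[x-y*z]+y*z (+ c) (+ suc m) (+ d) ⟩
    (+ c + -[1+ m ] * + d) + + suc m * + d ≡⟨ cong (_+ + suc m * + d) n≡c-md ⟨
    + n + + suc m * + d                    ≡⟨ pos-+-* n (suc m) d ⟨
    + (n ℕ.+ suc m ℕ.* d)                  ∎

-- The residue of A + B modulo 3, indexed by B so that matching on it rewrites B everywhere.
data SumMod3 (A : ℤ) : ℤ → Set where
  sum≡3k   : ∀ k → SumMod3 A (+ 0 + k * + 3 - A)
  sum≡3k+1 : ∀ k → SumMod3 A (+ 1 + k * + 3 - A)
  sum≡3k+2 : ∀ k → SumMod3 A (+ 2 + k * + 3 - A)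

sumMod3 : ∀ A B → SumMod3 A B
sumMod3 A B = classify ((A + B) %ℕ 3) ((A + B) /ℕ 3) (n%ℕd<d (A + B) 3)
                       (trans (B≡[A+B]-A A B) (cong (_- A) (a≡a%ℕn+[a/ℕn]*n (A + B) 3)))
  where
  B≡[A+B]-A : ∀ A B → B ≡ (A + B) - A
  B≡[A+B]-A = solve-∀
  classify : ∀ {B} r k → r < 3 → B ≡ + r + k * + 3 - A → SumMod3 A B
  classify 0 k _ refl = sum≡3k k
  classify 1 k _ refl = sum≡3k+1 k
  classify 2 k _ refl = sum≡3k+2 k
  classify (suc (suc (suc _))) _ (s≤s (s≤s (s≤s ()))) _

-- a + bω ↦ a + bω², using ω² = -1 - ω
conj : ℤω → ℤω
conj (mk a b) = mk (a - b) (- b)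

neg : ℤω → ℤω
neg (mk a b) = mk (- a) (- b)

-- The ring solver does not unfold ⊕, ⊗ and N, so the identities below are stated on the
-- components these operations compute.
N-conj : ∀ α → N (conj α) ≡ N α
N-conj (mk a b) = norm-identity a b
  where
  norm-identity : ∀ a b → (a - b) * (a - b) - (a - b) * - b + - b * - b ≡ a * a - a * b + b * b
  norm-identity = solve-∀

N-neg : ∀ α → N (neg α) ≡ N α
N-neg (mk a b) = norm-identity a b
  where
  norm-identity : ∀ a b → - a * - a - - a * - b + - b * - b ≡ a * a - a * b + b * b
  norm-identity = solve-∀

type1 : ℤ → ℤ → ℤω
type1 A B = mk (+ 2 * (+ 1 + + 3 * B)) (+ 3 * (+ 1 + + 2 * A))

N-type1 : ∀ A B → N (type1 A B) ≡ + 7 + + 6 * (A + B) + (+ 2 * A + + 4 * N (mk A B)) * + 9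
N-type1 A B = norm-identity A B
  where
  norm-identity : ∀ A B → let x = + 2 * (+ 1 + + 3 * B); y = + 3 * (+ 1 + + 2 * A) in
    x * x - x * y + y * y ≡ + 7 + + 6 * (A + B) + (+ 2 * A + + 4 * (A * A - A * B + B * B)) * + 9
  norm-identity = solve-∀

type1-mod9 : ∀ {p} A r k → + p ≡ N (type1 A (+ r + k * + 3 - A)) → p % 9 ≡ (7 ℕ.+ 6 ℕ.* r) % 9
type1-mod9 {p} A r k p≡N = n≡c+M*d⇒n%d≡c%d p (7 ℕ.+ 6 ℕ.* r) 9 (+ 2 * k + Q) (begin
  + p                                   ≡⟨ p≡N ⟩
  N (type1 A B)                         ≡⟨ N-type1 A B ⟩
  + 7 + + 6 * (A + B) + Q * + 9         ≡⟨ regroup A (+ r) k Q ⟩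
  + 7 + + 6 * + r + (+ 2 * k + Q) * + 9 ≡⟨ cong (_+ (+ 2 * k + Q) * + 9) (pos-+-* 7 6 r) ⟨
  + (7 ℕ.+ 6 ℕ.* r) + (+ 2 * k + Q) * + 9 ∎)
  where
  open ≡-Reasoning
  B = + r + k * + 3 - A
  Q = + 2 * A + + 4 * N (mk A B)
  regroup : ∀ A s k Q →
    + 7 + + 6 * (A + (s + k * + 3 - A)) + Q * + 9 ≡ + 7 + + 6 * s + (+ 2 * k + Q) * + 9
  regroup = solve-∀

rep : ℤ → ℤ → ℤ → ℤω
rep c A B = (ι c ⊕ (ι (- + 3) ⊗ ω)) ⊕ ((ι (+ 6) ⊗ (ω ⊕ ι (- + 1))) ⊗ ((ι A ⊗ ω) ⊕ ι B))

Aω+B≡mk : ∀ A B → (ι A ⊗ ω) ⊕ ι B ≡ mk B A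
Aω+B≡mk A B = cong₂ mk (re-identity A B) (im-identity A B)
  where
  re-identity : ∀ A B → A * + 0 - + 0 * + 1 + B ≡ B
  re-identity = solve-∀
  im-identity : ∀ A B → A * + 1 + + 0 * + 0 - + 0 * + 1 + + 0 ≡ A
  im-identity = solve-∀

rep-components : ∀ c A B → rep c A B ≡ mk (c - + 6 * (A + B)) (- + 3 - + 6 * (A + A - B))
rep-components c A B = begin
  rep c A B
    ≡⟨ cong (λ z → (ι c ⊕ (ι (- + 3) ⊗ ω)) ⊕ ((ι (+ 6) ⊗ (ω ⊕ ι (- + 1))) ⊗ z)) (Aω+B≡mk A B) ⟩
  mk (c + + 0) (- + 3) ⊕ (mk (- + 6) (+ 6) ⊗ mk B A)
    ≡⟨ cong₂ mk (re-identity c A B) (im-identity A B) ⟩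
  mk (c - + 6 * (A + B)) (- + 3 - + 6 * (A + A - B)) ∎
  where
  open ≡-Reasoning
  re-identity : ∀ c A B → c + + 0 + (- + 6 * B - + 6 * A) ≡ c - + 6 * (A + B)
  re-identity = solve-∀
  im-identity : ∀ A B → - + 3 + (- + 6 * A + + 6 * B - + 6 * A) ≡ - + 3 - + 6 * (A + A - B)
  im-identity = solve-∀

rep≡conj-type1 : ∀ A k → rep (- + 1) (A - k) (A - k - k) ≡ conj (type1 A (+ 0 + k * + 3 - A))
rep≡conj-type1 A k =
  trans (rep-components (- + 1) (A - k) (A - k - k)) (cong₂ mk (re-identity A k) (im-identity A k))
  where
  re-identity : ∀ A k → - + 1 - + 6 * (A - k + (A - k - k))
                      ≡ + 2 * (+ 1 + + 3 * (+ 0 + k * + 3 - A)) - + 3 * (+ 1 + + 2 * A)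
  re-identity = solve-∀
  im-identity : ∀ A k → - + 3 - + 6 * (A - k + (A - k) - (A - k - k)) ≡ - (+ 3 * (+ 1 + + 2 * A))
  im-identity = solve-∀

rep≡neg-conj-type1 : ∀ A k →
  rep (+ 1) (k - A) (+ 1 + k + k - A) ≡ neg (conj (type1 A (+ 1 + k * + 3 - A)))
rep≡neg-conj-type1 A k =
  trans (rep-components (+ 1) (k - A) (+ 1 + k + k - A)) (cong₂ mk (re-identity A k) (im-identity A k))
  where
  re-identity : ∀ A k → + 1 - + 6 * (k - A + (+ 1 + k + k - A))
                      ≡ - (+ 2 * (+ 1 + + 3 * (+ 1 + k * + 3 - A)) - + 3 * (+ 1 + + 2 * A))
  re-identity = solve-∀
  im-identity : ∀ A k → - + 3 - + 6 * (k - A + (k - A) - (+ 1 + k + k - A)) ≡ - - (+ 3 * (+ 1 + + 2 * A))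
  im-identity = solve-∀

lemma4 : (p : ℕ) → Type1Prime p →
    ((p % 9 ≡ 7) → ∃₂ λ (A B : ℤ) →
    + p ≡ N ((ι (- + 1) ⊕ (ι (- + 3) ⊗ ω)) ⊕ ((ι (+ 6) ⊗ (ω ⊕ ι (- + 1))) ⊗ ((ι A ⊗ ω) ⊕ ι B))))
    × ((p % 9 ≡ 4) → ∃₂ λ (A B : ℤ) →
    + p ≡ N ((ι (+ 1) ⊕ (ι (- + 3) ⊗ ω)) ⊕ ((ι (+ 6) ⊗ (ω ⊕ ι (- + 1))) ⊗ ((ι A ⊗ ω) ⊕ ι B))))
lemma4 p (_ , A , B , p≡N) with sumMod3 A B
... | sum≡3k k =
      (λ _ → A - k , A - k - k ,
        trans p≡N (sym (trans (cong N (rep≡conj-type1 A k)) (N-conj α))))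
    , λ p%9≡4 → contradiction (trans (sym p%9≡4) (type1-mod9 A 0 k p≡N)) λ ()
  where α = type1 A (+ 0 + k * + 3 - A)
... | sum≡3k+1 k =
      (λ p%9≡7 → contradiction (trans (sym p%9≡7) (type1-mod9 A 1 k p≡N)) λ ())
    , λ _ → k - A , + 1 + k + k - A ,
        trans p≡N (sym (trans (cong N (rep≡neg-conj-type1 A k))
                              (trans (N-neg (conj α)) (N-conj α))))
  where α = type1 A (+ 1 + k * + 3 - A)
... | sum≡3k+2 k =
      (λ p%9≡7 → contradiction (trans (sym p%9≡7) (type1-mod9 A 2 k p≡N)) λ ())
    , λ p%9≡4 → contradiction (trans (sym p%9≡4) (type1-mod9 A 2 k p≡N)) λ ()
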